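{- Let $k$ be a positive integer, and for a permutation $\pi$ of $\{1,\dots,k\}$ let $S_\pi=\{2^{2k+1}+2^{k+i}+2^{\pi(i)}: i\in\{1,\dots,k\}\}$. Let $\pi,\pi'$ be permutations of $\{1,\dots,k\}$, and suppose non-empty subsets $X\subseteq S_\pi$ and $X'\subseteq S_{\pi'}$ satisfy $\sum_{x\in X}x=\sum_{x'\in X'}x'$. Then there is a set $J\subseteq\{1,\dots,k\}$ such that $X=\{2^{2k+1}+2^{k+i}+2^{\pi(i)}: i\in J\}$, $X'=\{2^{2k+1}+2^{k+i}+2^{\pi'(i)}: i\in J\}$, and $\{\pi(i): i\in J\}=\{\pi'(i): i\in J\}$. -}

module Defs where

open import Data.Nat using (ℕ; suc; _+_; _*_; _^_)
open import Data.Fin using (Fin; toℕ)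
open import Data.Fin.Permutation using (Permutation′; _⟨$⟩ʳ_)
open import Data.Product using (∃)
open import Relation.Binary.PropositionalEquality using (_≡_)

-- Index i : Fin k represents the integer toℕ i + 1 ∈ {1,…,k};
-- the permutation π acts on Fin k, so π(i) is toℕ (π ⟨$⟩ʳ i) + 1.
-- elt k π i = 2^(2k+1) + 2^(k+i) + 2^(π(i))
elt : (k : ℕ) → Permutation′ k → Fin k → ℕ
elt k π i = 2 ^ (2 * k + 1) + 2 ^ (k + suc (toℕ i)) + 2 ^ suc (toℕ (π ⟨$⟩ʳ i))

InS : (k : ℕ) → Permutation′ k → ℕ → Set
InS k π x = ∃ λ i → x ≡ elt k π i

{-# OPTIONS --safe #-}
-- In binary, an element of S_π has three 1-bits: at 2k+1, at k+i and at π(i).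
-- When the distinct elements indexed by a set I are summed, each bit k+i and each
-- bit π(i) occurs at most once, so these two blocks add up without carries to a
-- number below 2^(2k+1). The sum therefore determines |I| (above the blocks), the
-- set I (middle block) and the set π(I) (lowest block): equal sums over S_π and
-- S_π′ force I = I′ and π(I) = π′(I′).
module Submission where

open import Defs
open import Data.Nat using (ℕ; zero; suc; _+_; _*_; _^_; _≤_; _<_; z≤n; s≤s; NonZero)
open import Data.Nat.Properties
open import Data.Nat.DivMod using (_%_; [m+kn]%n≡m%n; m<n⇒m%n≡m)
open import Data.Nat.ListAction using (sum)
open import Data.Nat.Tactic.RingSolver using (solve-∀)
open import Data.Fin using (Fin; toℕ; zero; suc) renaming (_≟_ to _≟ᶠ_)
open import Data.Fin.Permutation using (Permutation′; _⟨$⟩ʳ_)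
open import Data.Fin.Subset using (Subset; ⊥; ⁅_⁆; _∪_) renaming (_∈_ to _∈ₛ_)
open import Data.Fin.Subset.Properties using (∉⊥; x∈⁅x⁆; x∈⁅y⁆⇒x≡y; x∈p∪q⁺; x∈p∪q⁻)
open import Data.List using (List; []; _∷_; map; length)
open import Data.List.Membership.Propositional using (_∈_)
open import Data.List.Membership.Propositional.Properties using (∈-map⁺; ∈-map⁻)
open import Data.List.Relation.Unary.All using (All; []; _∷_)
open import Data.List.Relation.Unary.AllPairs using ([]; _∷_)
open import Data.List.Relation.Unary.Any using (here; there)
open import Data.List.Relation.Unary.Unique.Propositional using (Unique)
import Data.List.Relation.Unary.Unique.Propositional.Properties as Unique
open import Data.Product using (∃; _×_; _,_; proj₁; proj₂)
open import Data.Empty using (⊥-elim)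
open import Data.Sum using (inj₁; inj₂; [_,_])
import Function.Related.Propositional as Related
open import Function using (_∘_)
open import Function.Bundles using (_⇔_; mk⇔; Equivalence; Injection)
open import Function.Construct.Composition using (_⇔-∘_)
open import Function.Construct.Symmetry using (⇔-sym)
open import Function.Properties.Inverse using (↔⇒↣)
open import Relation.Nullary using (yes; no)
open import Relation.Binary.PropositionalEquality
  using (_≡_; _≢_; refl; sym; trans; cong; cong₂; subst; module ≡-Reasoning)

open Equivalence using (to; from)

remainder-quotient-unique : ∀ n .{{_ : NonZero n}} {r r′ q q′} → r < n → r′ < n →
                            r + q * n ≡ r′ + q′ * n → r ≡ r′ × q ≡ q′
remainder-quotient-unique n {r} {r′} {q} {q′} r<n r′<n eq =
  r≡r′ , *-cancelʳ-≡ q q′ n (+-cancelˡ-≡ r _ _ (trans eq (cong (_+ q′ * n) (sym r≡r′))))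
  where
  open ≡-Reasoning
  r≡r′ : r ≡ r′
  r≡r′ = begin
    r                 ≡⟨ m<n⇒m%n≡m r<n ⟨
    r % n             ≡⟨ [m+kn]%n≡m%n r q n ⟨
    (r + q * n) % n   ≡⟨ cong (_% n) eq ⟩
    (r′ + q′ * n) % n ≡⟨ [m+kn]%n≡m%n r′ q′ n ⟩
    r′ % n            ≡⟨ m<n⇒m%n≡m r′<n ⟩
    r′                ∎

m+o*n<n*n : ∀ {m n o} → m < n → o < n → m + o * n < n * n
m+o*n<n*n {m} {n} {o} m<n o<n = begin-strict
  m + o * n <⟨ +-monoˡ-< (o * n) m<n ⟩
  n + o * n ≡⟨⟩
  suc o * n ≤⟨ *-monoˡ-≤ n o<n ⟩
  n * n     ∎
  where open ≤-Reasoning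

fromDigits : ∀ {k} → (Fin k → ℕ) → ℕ
fromDigits {zero}  c = 0
fromDigits {suc k} c = c zero + fromDigits (λ i → c (suc i)) * 2

Bits : ∀ {k} → (Fin k → ℕ) → Set
Bits c = ∀ i → c i ≤ 1

δ : ∀ {k} → Fin k → Fin k → ℕ
δ zero    zero    = 1
δ zero    (suc _) = 0
δ (suc _) zero    = 0
δ (suc i) (suc j) = δ i j

δ-refl : ∀ {k} (i : Fin k) → δ i i ≡ 1
δ-refl zero    = refl
δ-refl (suc i) = δ-refl i

δ-≢ : ∀ {k} {i j : Fin k} → i ≢ j → δ i j ≡ 0
δ-≢ {i = zero}  {zero}  i≢j = ⊥-elim (i≢j refl)
δ-≢ {i = zero}  {suc j} i≢j = refl
δ-≢ {i = suc i} {zero}  i≢j = refl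
δ-≢ {i = suc i} {suc j} i≢j = δ-≢ (i≢j ∘ cong suc)

fromDigits-0 : ∀ {k} → fromDigits {k} (λ _ → 0) ≡ 0
fromDigits-0 {zero}  = refl
fromDigits-0 {suc k} = cong (_* 2) (fromDigits-0 {k})

fromDigits-δ : ∀ {k} (j : Fin k) → fromDigits (λ i → δ i j) ≡ 2 ^ toℕ j
fromDigits-δ {suc k} zero    = cong (λ x → 1 + x * 2) (fromDigits-0 {k})
fromDigits-δ         (suc j) = trans (cong (_* 2) (fromDigits-δ j)) (*-comm (2 ^ toℕ j) 2)

fromDigits-+ : ∀ {k} (c d : Fin k → ℕ) →
               fromDigits (λ i → c i + d i) ≡ fromDigits c + fromDigits d
fromDigits-+ {zero}  c d = refl
fromDigits-+ {suc k} c d = begin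
  c zero + d zero + fromDigits (λ i → c (suc i) + d (suc i)) * 2
    ≡⟨ cong (λ x → c zero + d zero + x * 2) (fromDigits-+ (λ i → c (suc i)) (λ i → d (suc i))) ⟩
  c zero + d zero + (fromDigits (λ i → c (suc i)) + fromDigits (λ i → d (suc i))) * 2
    ≡⟨ rearrange (c zero) (d zero) (fromDigits (λ i → c (suc i))) (fromDigits (λ i → d (suc i))) ⟩
  c zero + fromDigits (λ i → c (suc i)) * 2 + (d zero + fromDigits (λ i → d (suc i)) * 2) ∎
  where
  open ≡-Reasoning
  rearrange : ∀ a b x y → a + b + (x + y) * 2 ≡ a + x * 2 + (b + y * 2)
  rearrange = solve-∀

fromDigits-< : ∀ {k} {c : Fin k → ℕ} → Bits c → fromDigits c < 2 ^ k
fromDigits-< {zero}      bits = s≤s z≤n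
fromDigits-< {suc k} {c} bits = begin-strict
  c zero + x * 2   <⟨ +-monoˡ-≤ (x * 2) (s≤s (bits zero)) ⟩
  2 + x * 2        ≡⟨⟩
  suc x * 2        ≤⟨ *-monoˡ-≤ 2 (fromDigits-< (λ i → bits (suc i))) ⟩
  2 ^ k * 2        ≡⟨ *-comm (2 ^ k) 2 ⟩
  2 ^ suc k        ∎
  where
  open ≤-Reasoning
  x : ℕ
  x = fromDigits (λ i → c (suc i))

fromDigits-injective : ∀ {k} {c d : Fin k → ℕ} → Bits c → Bits d →
                       fromDigits c ≡ fromDigits d → ∀ i → c i ≡ d i
fromDigits-injective {suc k} {c} {d} bits-c bits-d eq = λ where
    zero    → proj₁ split
    (suc i) → fromDigits-injective (λ j → bits-c (suc j)) (λ j → bits-d (suc j)) (proj₂ split) i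
  where
  split : c zero ≡ d zero × fromDigits (λ i → c (suc i)) ≡ fromDigits (λ i → d (suc i))
  split = remainder-quotient-unique 2 (s≤s (bits-c zero)) (s≤s (bits-d zero)) eq

multiplicity : ∀ {k} → Fin k → List (Fin k) → ℕ
multiplicity i []      = 0
multiplicity i (j ∷ L) = δ i j + multiplicity i L

∈⇒1≤multiplicity : ∀ {k} {i : Fin k} {L} → i ∈ L → 1 ≤ multiplicity i L
∈⇒1≤multiplicity {i = i} {i ∷ L} (here refl) =
  subst (λ d → 1 ≤ d + multiplicity i L) (sym (δ-refl i)) (s≤s z≤n)
∈⇒1≤multiplicity {i = i} {j ∷ L} (there i∈L) =
  ≤-trans (∈⇒1≤multiplicity i∈L) (m≤n+m _ (δ i j))

1≤multiplicity⇒∈ : ∀ {k} {i : Fin k} L → 1 ≤ multiplicity i L → i ∈ L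
1≤multiplicity⇒∈ {i = i} (j ∷ L) 1≤m with i ≟ᶠ j
... | yes refl = here refl
... | no i≢j   =
  there (1≤multiplicity⇒∈ L (subst (λ d → 1 ≤ d + multiplicity i L) (δ-≢ i≢j) 1≤m))

∉⇒multiplicity≡0 : ∀ {k} {i : Fin k} {L} → All (i ≢_) L → multiplicity i L ≡ 0
∉⇒multiplicity≡0 []           = refl
∉⇒multiplicity≡0 (i≢j ∷ i∉L) = cong₂ _+_ (δ-≢ i≢j) (∉⇒multiplicity≡0 i∉L)

Unique⇒Bits : ∀ {k} {L : List (Fin k)} → Unique L → Bits (λ i → multiplicity i L)
Unique⇒Bits []                      i = z≤n
Unique⇒Bits {L = j ∷ L} (j∉L ∷ uniq) i with i ≟ᶠ j
... | yes refl = ≤-reflexive (cong₂ _+_ (δ-refl i) (∉⇒multiplicity≡0 j∉L))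
... | no i≢j   = subst (λ d → d + multiplicity i L ≤ 1) (sym (δ-≢ i≢j)) (Unique⇒Bits uniq i)

sum2^ : ∀ {k} → List (Fin k) → ℕ
sum2^ L = sum (map (λ i → 2 ^ toℕ i) L)

sum2^≡fromDigits : ∀ {k} (L : List (Fin k)) → sum2^ L ≡ fromDigits (λ i → multiplicity i L)
sum2^≡fromDigits {k} []  = sym (fromDigits-0 {k})
sum2^≡fromDigits (j ∷ L) = begin
  2 ^ toℕ j + sum2^ L
    ≡⟨ cong₂ _+_ (sym (fromDigits-δ j)) (sum2^≡fromDigits L) ⟩
  fromDigits (λ i → δ i j) + fromDigits (λ i → multiplicity i L)
    ≡⟨ fromDigits-+ (λ i → δ i j) (λ i → multiplicity i L) ⟨
  fromDigits (λ i → δ i j + multiplicity i L) ∎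
  where open ≡-Reasoning

sum2^-< : ∀ {k} {L : List (Fin k)} → Unique L → sum2^ L < 2 ^ k
sum2^-< {L = L} uniq = subst (_< _) (sym (sum2^≡fromDigits L)) (fromDigits-< (Unique⇒Bits uniq))

sum2^-injective : ∀ {k} {L L′ : List (Fin k)} → Unique L → Unique L′ →
                  sum2^ L ≡ sum2^ L′ → ∀ {i} → i ∈ L ⇔ i ∈ L′
sum2^-injective {L = L} {L′} uniq uniq′ eq {i} =
  mk⇔ (1≤multiplicity⇒∈ L′ ∘ subst (1 ≤_) (same-multiplicity i) ∘ ∈⇒1≤multiplicity)
      (1≤multiplicity⇒∈ L ∘ subst (1 ≤_) (sym (same-multiplicity i)) ∘ ∈⇒1≤multiplicity)
  where
  same-multiplicity : ∀ i → multiplicity i L ≡ multiplicity i L′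
  same-multiplicity = fromDigits-injective (Unique⇒Bits uniq) (Unique⇒Bits uniq′)
    (trans (sym (sum2^≡fromDigits L)) (trans eq (sum2^≡fromDigits L′)))

2^[2k+1]≡2*[2^k*2^k] : ∀ k → 2 ^ (2 * k + 1) ≡ 2 * (2 ^ k * 2 ^ k)
2^[2k+1]≡2*[2^k*2^k] k = begin
  2 ^ (2 * k + 1)   ≡⟨ cong (2 ^_) (exponent k) ⟩
  2 * 2 ^ (k + k)   ≡⟨ cong (2 *_) (^-distribˡ-+-* 2 k k) ⟩
  2 * (2 ^ k * 2 ^ k) ∎
  where
  open ≡-Reasoning
  exponent : ∀ k → 2 * k + 1 ≡ suc (k + k)
  exponent = solve-∀

sum-map-elt : ∀ k (π : Permutation′ k) I → sum (map (elt k π) I) ≡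
  2 * (sum2^ (map (π ⟨$⟩ʳ_) I) + sum2^ I * 2 ^ k) + length I * 2 ^ (2 * k + 1)
sum-map-elt k π []      = refl
sum-map-elt k π (j ∷ I) = begin
  2 ^ (2 * k + 1) + 2 ^ (k + suc (toℕ j)) + 2 * 2 ^ toℕ (π ⟨$⟩ʳ j) + sum (map (elt k π) I)
    ≡⟨ cong₂ (λ p s → 2 ^ (2 * k + 1) + p + 2 * 2 ^ toℕ (π ⟨$⟩ʳ j) + s)
             (^-distribˡ-+-* 2 k (suc (toℕ j))) (sum-map-elt k π I) ⟩
  2 ^ (2 * k + 1) + 2 ^ k * (2 * 2 ^ toℕ j) + 2 * 2 ^ toℕ (π ⟨$⟩ʳ j)
    + (2 * (sum2^ (map (π ⟨$⟩ʳ_) I) + sum2^ I * 2 ^ k) + length I * 2 ^ (2 * k + 1))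
    ≡⟨ rearrange (2 ^ (2 * k + 1)) (2 ^ k) (2 ^ toℕ j) (2 ^ toℕ (π ⟨$⟩ʳ j))
                 (sum2^ I) (sum2^ (map (π ⟨$⟩ʳ_) I)) (length I) ⟩
  2 * (sum2^ (map (π ⟨$⟩ʳ_) (j ∷ I)) + sum2^ (j ∷ I) * 2 ^ k) + length (j ∷ I) * 2 ^ (2 * k + 1) ∎
  where
  open ≡-Reasoning
  rearrange : ∀ t n p q a b l →
    t + n * (2 * p) + 2 * q + (2 * (b + a * n) + l * t) ≡ 2 * ((q + b) + (p + a) * n) + suc l * t
  rearrange = solve-∀

sum-map-elt-injective : ∀ k (π π′ : Permutation′ k) {I I′} → Unique I → Unique I′ →
  sum (map (elt k π) I) ≡ sum (map (elt k π′) I′) →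
  (∀ {i} → i ∈ I ⇔ i ∈ I′) × (∀ {m} → m ∈ map (π ⟨$⟩ʳ_) I ⇔ m ∈ map (π′ ⟨$⟩ʳ_) I′)
sum-map-elt-injective k π π′ {I} {I′} uniq uniq′ eq =
  sum2^-injective uniq uniq′ (proj₂ blocks≡) ,
  sum2^-injective (image-unique π uniq) (image-unique π′ uniq′) (proj₁ blocks≡)
  where
  instance
    2^k≢0 : NonZero (2 ^ k)
    2^k≢0 = m^n≢0 2 k
    2^[2k+1]≢0 : NonZero (2 ^ (2 * k + 1))
    2^[2k+1]≢0 = m^n≢0 2 (2 * k + 1)

  image-unique : ∀ (σ : Permutation′ k) {J} → Unique J → Unique (map (σ ⟨$⟩ʳ_) J)
  image-unique σ = Unique.map⁺ (Injection.injective (↔⇒↣ σ))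

  blocks : Permutation′ k → List (Fin k) → ℕ
  blocks σ J = sum2^ (map (σ ⟨$⟩ʳ_) J) + sum2^ J * 2 ^ k

  low< : ∀ σ {J} → Unique J → 2 * blocks σ J < 2 ^ (2 * k + 1)
  low< σ {J} u = begin-strict
    2 * blocks σ J       <⟨ *-monoʳ-< 2 (m+o*n<n*n (sum2^-< (image-unique σ u)) (sum2^-< u)) ⟩
    2 * (2 ^ k * 2 ^ k)  ≡⟨ 2^[2k+1]≡2*[2^k*2^k] k ⟨
    2 ^ (2 * k + 1)      ∎
    where open ≤-Reasoning

  low≡ : 2 * blocks π I ≡ 2 * blocks π′ I′
  low≡ = proj₁ (remainder-quotient-unique (2 ^ (2 * k + 1)) {q = length I} {q′ = length I′}
           (low< π uniq) (low< π′ uniq′)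
           (trans (sym (sum-map-elt k π I)) (trans eq (sum-map-elt k π′ I′))))

  blocks≡ : sum2^ (map (π ⟨$⟩ʳ_) I) ≡ sum2^ (map (π′ ⟨$⟩ʳ_) I′) × sum2^ I ≡ sum2^ I′
  blocks≡ = remainder-quotient-unique (2 ^ k)
              (sum2^-< (image-unique π uniq)) (sum2^-< (image-unique π′ uniq′))
              (*-cancelˡ-≡ (blocks π I) (blocks π′ I′) 2 low≡)

All-InS⇒map-elt : ∀ {k} (π : Permutation′ k) {X} → All (InS k π) X → ∃ λ I → X ≡ map (elt k π) I
All-InS⇒map-elt π []                = [] , refl
All-InS⇒map-elt π ((i , x≡) ∷ allX) =
  let I , X≡ = All-InS⇒map-elt π allX in i ∷ I , cong₂ _∷_ x≡ X≡

toSubset : ∀ {k} → List (Fin k) → Subset k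
toSubset []      = ⊥
toSubset (j ∷ L) = ⁅ j ⁆ ∪ toSubset L

∈-toSubset⇔∈ : ∀ {k} {i : Fin k} L → i ∈ₛ toSubset L ⇔ i ∈ L
∈-toSubset⇔∈ []      = mk⇔ (⊥-elim ∘ ∉⊥) (λ ())
∈-toSubset⇔∈ (j ∷ L) = mk⇔
  ([ here ∘ x∈⁅y⁆⇒x≡y j , there ∘ to (∈-toSubset⇔∈ L) ] ∘ x∈p∪q⁻ ⁅ j ⁆ (toSubset L))
  (λ { (here refl)  → x∈p∪q⁺ (inj₁ (x∈⁅x⁆ j))
     ; (there i∈L) → x∈p∪q⁺ (inj₂ (from (∈-toSubset⇔∈ L) i∈L)) })

∈-map⇔∃∈ₛ : ∀ {k} {B : Set} {J : Subset k} {L} (f : Fin k → B) → (∀ {i} → i ∈ₛ J ⇔ i ∈ L) →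
            ∀ {y} → y ∈ map f L ⇔ (∃ λ i → i ∈ₛ J × y ≡ f i)
∈-map⇔∃∈ₛ f J⇔L = mk⇔
  (λ y∈ → let i , i∈L , y≡ = ∈-map⁻ f y∈ in i , from J⇔L i∈L , y≡)
  (λ { (i , i∈J , refl) → ∈-map⁺ f (to J⇔L i∈J) })

∃-≡-sym : ∀ {A B : Set} {P : A → Set} {f : A → B} {y} →
          (∃ λ a → P a × f a ≡ y) ⇔ (∃ λ a → P a × y ≡ f a)
∃-≡-sym = mk⇔ (λ (a , p , e) → a , p , sym e) (λ (a , p , e) → a , p , sym e)

lemma5p7 : (k : ℕ) → 0 < k → (π π′ : Permutation′ k) → (X X′ : List ℕ) →
    Unique X → Unique X′ → X ≢ [] → X′ ≢ [] →
    All (InS k π) X → All (InS k π′) X′ →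
    sum X ≡ sum X′ →
    ∃ λ (J : Subset k) →
      (∀ x → (x ∈ X) ⇔ (∃ λ i → i ∈ₛ J × x ≡ elt k π i)) ×
      (∀ x → (x ∈ X′) ⇔ (∃ λ i → i ∈ₛ J × x ≡ elt k π′ i)) ×
      (∀ (m : Fin k) → (∃ λ i → i ∈ₛ J × π ⟨$⟩ʳ i ≡ m) ⇔ (∃ λ i → i ∈ₛ J × π′ ⟨$⟩ʳ i ≡ m))
lemma5p7 k _ π π′ X X′ uniqX uniqX′ _ _ allX allX′ eq
  with All-InS⇒map-elt π allX | All-InS⇒map-elt π′ allX′
... | I , refl | I′ , refl =
  toSubset I , (λ _ → ∈-map⇔∃∈ₛ (elt k π) J⇔I) , (λ _ → ∈-map⇔∃∈ₛ (elt k π′) J⇔I′) , same-image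
  where
  same-indices-and-values : (∀ {i} → i ∈ I ⇔ i ∈ I′) ×
                            (∀ {m} → m ∈ map (π ⟨$⟩ʳ_) I ⇔ m ∈ map (π′ ⟨$⟩ʳ_) I′)
  same-indices-and-values =
    sum-map-elt-injective k π π′ (Unique.map⁻ uniqX) (Unique.map⁻ uniqX′) eq

  J : Subset k
  J = toSubset I

  J⇔I : ∀ {i} → i ∈ₛ J ⇔ i ∈ I
  J⇔I = ∈-toSubset⇔∈ I

  J⇔I′ : ∀ {i} → i ∈ₛ J ⇔ i ∈ I′
  J⇔I′ = proj₁ same-indices-and-values ⇔-∘ J⇔I

  same-image : ∀ m → (∃ λ i → i ∈ₛ J × π ⟨$⟩ʳ i ≡ m) ⇔ (∃ λ i → i ∈ₛ J × π′ ⟨$⟩ʳ i ≡ m)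
  same-image m = begin
    (∃ λ i → i ∈ₛ J × π ⟨$⟩ʳ i ≡ m)   ∼⟨ ∃-≡-sym ⟩
    (∃ λ i → i ∈ₛ J × m ≡ π ⟨$⟩ʳ i)   ∼⟨ ⇔-sym (∈-map⇔∃∈ₛ (π ⟨$⟩ʳ_) J⇔I) ⟩
    m ∈ map (π ⟨$⟩ʳ_) I               ∼⟨ proj₂ same-indices-and-values ⟩
    m ∈ map (π′ ⟨$⟩ʳ_) I′             ∼⟨ ∈-map⇔∃∈ₛ (π′ ⟨$⟩ʳ_) J⇔I′ ⟩
    (∃ λ i → i ∈ₛ J × m ≡ π′ ⟨$⟩ʳ i)  ∼⟨ ⇔-sym ∃-≡-sym ⟩
    (∃ λ i → i ∈ₛ J × π′ ⟨$⟩ʳ i ≡ m)  ∎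
    where open Related.EquationalReasoning
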